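{- Let $(G,\sigma)$ be a signed graph, $u$ a vertex of $G$, and $l\ge 1$. Let $(G,\sigma)^{l+1}$ be obtained from $(G,\sigma)$ by adding new vertices $u_1,\dots,u_l$ and positive edges $uu_1,u_1u_2,\dots,u_{l-1}u_l$. Then for every positive integer $k$, $\chi^b_{(G,\sigma)^{l+1}}(2k)=(2k-1)^l\,\chi^b_{(G,\sigma)}(2k)$.
   Context: A signed graph $(G,\sigma)$ is a finite graph $G$ (parallel edges and loops allowed) with a sign function $\sigma:E(G)\to\{+1,-1\}$. A zero-free signed coloring in $2k$ colors is a map $c:V(G)\to\{ -k,\dots,-1,1,\dots,k\}$; it is proper if $c(y)\neq\sigma(e)c(x)$ for every edge $e=xy$ (including loops). The balanced chromatic polynomial $\chi^b_{(G,\sigma)}(2k)$ is the number of proper zero-free signed colorings in $2k$ colors. -}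

module Defs where

open import Data.Nat using (ℕ; zero; suc; _+_)
open import Data.Integer using (ℤ; +_; -_; -[1+_])
import Data.Integer as ℤ
open import Data.Fin using (Fin; zero; suc; _↑ˡ_; _↑ʳ_; inject₁)
open import Data.List using (List; []; _∷_; map; _++_; concatMap; filter; length; allFin)
open import Data.Vec using (Vec; []; _∷_; lookup)
open import Data.Product using (_×_; _,_)
open import Data.Sign using (Sign) renaming (+ to pos; - to neg)
open import Data.List.Relation.Unary.All using (All; all?)
open import Relation.Nullary using (¬_; Dec)
open import Relation.Nullary.Decidable using (¬?)
open import Relation.Binary.PropositionalEquality using (_≡_)

-- A signed edge: endpoints x, y and a sign.  A loop is an edge with x ≡ y;
-- parallel edges are repeated list entries.
Edge : ℕ → Set
Edge n = Fin n × Fin n × Sign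

record SignedGraph : Set where
  field
    n     : ℕ
    edges : List (Edge n)
open SignedGraph public

applySign : Sign → ℤ → ℤ
applySign pos a = a
applySign neg a = - a

-- The 2k zero-free colours  -k,…,-1,1,…,k  as integers.
colours : ℕ → List ℤ
colours k = concatMap (λ (i : Fin k) → + suc (Data.Fin.toℕ i) ∷ -[1+ Data.Fin.toℕ i ] ∷ []) (allFin k)

allColourings : ℕ → (n : ℕ) → List (Vec ℤ n)
allColourings k zero    = [] ∷ []
allColourings k (suc n) = concatMap (λ a → map (a ∷_) (allColourings k n)) (colours k)

ProperAt : ∀ {n} → Vec ℤ n → Edge n → Set
ProperAt c (x , y , s) = ¬ (lookup c y ≡ applySign s (lookup c x))

properAt? : ∀ {n} (c : Vec ℤ n) (e : Edge n) → Dec (ProperAt c e)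
properAt? c (x , y , s) = ¬? (lookup c y ℤ.≟ applySign s (lookup c x))

Proper : (G : SignedGraph) → Vec ℤ (n G) → Set
Proper G c = All (ProperAt c) (edges G)

proper? : (G : SignedGraph) (c : Vec ℤ (n G)) → Dec (Proper G c)
proper? G c = all? (properAt? c) (edges G)

-- Balanced chromatic polynomial evaluated at 2k: the number of proper
-- zero-free signed colourings in 2k colours.
χᵇ : SignedGraph → ℕ → ℕ
χᵇ G k = length (filter (proper? G) (allColourings k (n G)))

-- (G,σ)^{l+1}: add new vertices u₁,…,u_l (vertex n ↑ʳ (i-1)) and positive
-- edges u u₁, u₁ u₂, …, u_{l-1} u_l.  Old vertex v becomes v ↑ˡ l.
pendantPath : (G : SignedGraph) → Fin (n G) → ℕ → SignedGraph
pendantPath G u zero = G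
pendantPath G u (suc m) = record
  { n     = n G + suc m
  ; edges = map (λ (e : Edge (n G)) → liftE e) (edges G)
            ++ (u ↑ˡ suc m , n G ↑ʳ zero , pos)
            ∷ map (λ (i : Fin m) → (n G ↑ʳ inject₁ i , n G ↑ʳ suc i , pos)) (allFin m)
  }
  where
  liftE : Edge (n G) → Edge (n G + suc m)
  liftE (x , y , s) = x ↑ˡ suc m , y ↑ˡ suc m , s

module Submission where

-- The vertices of (G,σ)^{l+1} are those of G followed by the
-- new path u₁,…,u_l, so a colouring of it is a concatenation c ++ d of a
-- colouring c of G and a colouring d of the path.  Its edges are the edges
-- of G together with the positive path edges, hence c ++ d is proper iff
-- c is proper for G and d is a walk avoiding its predecessor:
-- d₁ ≠ c(u) and d_{i+1} ≠ d_i.  For any colour a exactly 2k-1 of the 2k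
-- colours differ from a, so there are (2k-1)^l such walks starting next to
-- a colour a, whatever a is.

open import Defs
open import Data.Nat using (ℕ; zero; suc; _+_; _*_; _^_; _∸_; _≤_)
import Data.Nat.Properties as ℕ
open import Data.Bool using (Bool; true; false; not; _∧_)
open import Data.Bool.Properties using (∧-assoc)
open import Data.Integer using (ℤ; -[1+_])
import Data.Integer as ℤ
open import Data.Fin using (Fin; zero; suc; toℕ; _↑ˡ_; _↑ʳ_; inject₁)
open import Data.List using (List; []; _∷_; map; _++_; concatMap; filter; length; allFin; tabulate)
open import Data.List.Properties using (map-tabulate)
open import Data.Vec using (Vec; []; _∷_; lookup) renaming (_++_ to _++ᵛ_)
open import Data.Vec.Properties using (lookup-++ˡ; lookup-++ʳ)
open import Data.Product using (Σ; _,_)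
open import Data.Sign using (Sign) renaming (+ to pos; - to neg)
open import Data.List.Relation.Unary.All using (all?)
open import Relation.Unary using (Decidable)
open import Relation.Nullary using (does)
open import Relation.Binary.PropositionalEquality
  using (_≡_; refl; sym; trans; cong; cong₂; module ≡-Reasoning)

private
  variable
    A B : Set

𝟙 : Bool → ℕ
𝟙 true  = 1
𝟙 false = 0

sumBy : (A → ℕ) → List A → ℕ
sumBy g []       = 0
sumBy g (x ∷ xs) = g x + sumBy g xs

length-filter : {P : A → Set} (p? : Decidable P) (xs : List A) →
  length (filter p? xs) ≡ sumBy (λ x → 𝟙 (does (p? x))) xs
length-filter p? []       = refl
length-filter p? (x ∷ xs) with does (p? x)
... | true  = cong suc (length-filter p? xs)
... | false = length-filter p? xs

sumBy-cong : {g h : A → ℕ} → (∀ x → g x ≡ h x) → (xs : List A) → sumBy g xs ≡ sumBy h xs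
sumBy-cong g≗h []       = refl
sumBy-cong g≗h (x ∷ xs) = cong₂ _+_ (g≗h x) (sumBy-cong g≗h xs)

sumBy-++ : (g : A → ℕ) (xs ys : List A) → sumBy g (xs ++ ys) ≡ sumBy g xs + sumBy g ys
sumBy-++ g []       ys = refl
sumBy-++ g (x ∷ xs) ys = trans (cong (g x +_) (sumBy-++ g xs ys)) (sym (ℕ.+-assoc (g x) _ _))

sumBy-map : (g : B → ℕ) (f : A → B) (xs : List A) → sumBy g (map f xs) ≡ sumBy (λ x → g (f x)) xs
sumBy-map g f []       = refl
sumBy-map g f (x ∷ xs) = cong (g (f x) +_) (sumBy-map g f xs)

sumBy-concatMap : (g : B → ℕ) (f : A → List B) (xs : List A) →
  sumBy g (concatMap f xs) ≡ sumBy (λ x → sumBy g (f x)) xs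
sumBy-concatMap g f []       = refl
sumBy-concatMap g f (x ∷ xs) =
  trans (sumBy-++ g (f x) (concatMap f xs)) (cong (sumBy g (f x) +_) (sumBy-concatMap g f xs))

sumBy-*ʳ : (g : A → ℕ) (r : ℕ) (xs : List A) → sumBy (λ x → g x * r) xs ≡ sumBy g xs * r
sumBy-*ʳ g r []       = refl
sumBy-*ʳ g r (x ∷ xs) = trans (cong (g x * r +_) (sumBy-*ʳ g r xs)) (sym (ℕ.*-distribʳ-+ r (g x) _))

sumBy-∧ : (b : Bool) (f : A → Bool) (xs : List A) →
  sumBy (λ x → 𝟙 (b ∧ f x)) xs ≡ 𝟙 b * sumBy (λ x → 𝟙 (f x)) xs
sumBy-∧ true  f xs = sym (ℕ.+-identityʳ _)
sumBy-∧ false f []       = refl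
sumBy-∧ false f (x ∷ xs) = sumBy-∧ false f xs

sumFin : (m : ℕ) → (Fin m → ℕ) → ℕ
sumFin zero    h = 0
sumFin (suc m) h = h zero + sumFin m (λ i → h (suc i))

sumFin-cong : (m : ℕ) {g h : Fin m → ℕ} → (∀ i → g i ≡ h i) → sumFin m g ≡ sumFin m h
sumFin-cong zero    g≗h = refl
sumFin-cong (suc m) g≗h = cong₂ _+_ (g≗h zero) (sumFin-cong m (λ i → g≗h (suc i)))

sumFin-const : (m r : ℕ) → sumFin m (λ _ → r) ≡ m * r
sumFin-const zero    r = refl
sumFin-const (suc m) r = cong (r +_) (sumFin-const m r)

sumBy-tabulate : (m : ℕ) (g : A → ℕ) (f : Fin m → A) → sumBy g (tabulate f) ≡ sumFin m (λ i → g (f i))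
sumBy-tabulate zero    g f = refl
sumBy-tabulate (suc m) g f = cong (g (f zero) +_) (sumBy-tabulate m g (λ i → f (suc i)))

⋀ : (m : ℕ) → (Fin m → Bool) → Bool
⋀ zero    f = true
⋀ (suc m) f = f zero ∧ ⋀ m (λ i → f (suc i))

⋀-cong : (m : ℕ) {f g : Fin m → Bool} → (∀ i → f i ≡ g i) → ⋀ m f ≡ ⋀ m g
⋀-cong zero    f≗g = refl
⋀-cong (suc m) f≗g = cong₂ _∧_ (f≗g zero) (⋀-cong m (λ i → f≗g (suc i)))

-- Deciding  All  over lists, as booleans
-- (does (all? p (x ∷ xs)) is definitionally  does (p x) ∧ does (all? p xs).)

all?-++ : {P : A → Set} (p : Decidable P) (xs ys : List A) →
  does (all? p (xs ++ ys)) ≡ does (all? p xs) ∧ does (all? p ys)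
all?-++ p []       ys = refl
all?-++ p (x ∷ xs) ys = trans (cong (does (p x) ∧_) (all?-++ p xs ys)) (sym (∧-assoc (does (p x)) _ _))

all?-map : {P : B → Set} {Q : A → Set} (p : Decidable P) (q : Decidable Q) (f : A → B) →
  (∀ x → does (p (f x)) ≡ does (q x)) → (xs : List A) → does (all? p (map f xs)) ≡ does (all? q xs)
all?-map p q f pf≗q []       = refl
all?-map p q f pf≗q (x ∷ xs) = cong₂ _∧_ (pf≗q x) (all?-map p q f pf≗q xs)

all?-tabulate : {P : A → Set} (p : Decidable P) (m : ℕ) (f : Fin m → A) →
  does (all? p (tabulate f)) ≡ ⋀ m (λ i → does (p (f i)))
all?-tabulate p zero    f = refl
all?-tabulate p (suc m) f = cong (does (p (f zero)) ∧_) (all?-tabulate p m (λ i → f (suc i)))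

colour : Sign → ℕ → ℤ
colour pos j = ℤ.+ suc j
colour neg j = -[1+ j ]

IsColour : ℕ → ℤ → Set
IsColour k a = Σ (Fin k) λ j → Σ Sign λ s → a ≡ colour s (toℕ j)

sumBy-colours : (k : ℕ) (g : ℤ → ℕ) →
  sumBy g (colours k) ≡ sumFin k (λ j → g (colour pos (toℕ j)) + (g (colour neg (toℕ j)) + 0))
sumBy-colours k g = trans (sumBy-concatMap g _ (allFin k)) (sumBy-tabulate k _ (λ j → j))

colours-cong : (k : ℕ) {g h : ℤ → ℕ} → (∀ a → IsColour k a → g a ≡ h a) →
  sumBy g (colours k) ≡ sumBy h (colours k)
colours-cong k {g} {h} g≗h = begin
  sumBy g (colours k)
    ≡⟨ sumBy-colours k g ⟩
  sumFin k (λ j → g (colour pos (toℕ j)) + (g (colour neg (toℕ j)) + 0))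
    ≡⟨ sumFin-cong k (λ j → cong₂ _+_ (g≗h _ (j , pos , refl))
                                      (cong (_+ 0) (g≗h _ (j , neg , refl)))) ⟩
  sumFin k (λ j → h (colour pos (toℕ j)) + (h (colour neg (toℕ j)) + 0))
    ≡⟨ sym (sumBy-colours k h) ⟩
  sumBy h (colours k)
    ∎ where open ≡-Reasoning

-- x ≠ᵇ a decides x ≠ a; it is the properness of a positive edge coloured a, x.
_≠ᵇ_ : ℤ → ℤ → Bool
x ≠ᵇ a = not (does (x ℤ.≟ a))

-- The number 2k-1 of colours avoiding a fixed one, for k ≥ 1.
2[1+k]∸1 : (k : ℕ) → 2 * suc k ∸ 1 ≡ suc (2 * k)
2[1+k]∸1 k = ℕ.+-suc k (k + 0)

-- Among the 2(k+1) colours, exactly 2k+1 differ from a given colour.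
-- The comparisons reduce by computation once the sign of a is known.
avoiding : (k : ℕ) (s : Sign) (j : Fin (suc k)) →
  sumFin (suc k) (λ i → 𝟙 (colour pos (toℕ i) ≠ᵇ colour s (toℕ j))
                      + (𝟙 (colour neg (toℕ i) ≠ᵇ colour s (toℕ j)) + 0))
  ≡ suc (2 * k)
avoiding k       pos zero    = cong suc (trans (sumFin-const k 2) (ℕ.*-comm k 2))
avoiding k       neg zero    = cong suc (trans (sumFin-const k 2) (ℕ.*-comm k 2))
avoiding (suc k) pos (suc j) = cong (2 +_) (trans (avoiding k pos j) (sym (2[1+k]∸1 k)))
avoiding (suc k) neg (suc j) = cong (2 +_) (trans (avoiding k neg j) (sym (2[1+k]∸1 k)))

colours-avoiding : (k : ℕ) (a : ℤ) → IsColour k a →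
  sumBy (λ x → 𝟙 (x ≠ᵇ a)) (colours k) ≡ 2 * k ∸ 1
colours-avoiding (suc k) a (j , s , refl) =
  trans (sumBy-colours (suc k) (λ x → 𝟙 (x ≠ᵇ a))) (trans (avoiding k s j) (sym (2[1+k]∸1 k)))

ColourVec : (k : ℕ) {N : ℕ} → Vec ℤ N → Set
ColourVec k {N} c = ∀ (i : Fin N) → IsColour k (lookup c i)

sumBy-allColourings-suc : (k N : ℕ) (g : Vec ℤ (suc N) → ℕ) →
  sumBy g (allColourings k (suc N))
  ≡ sumBy (λ a → sumBy (λ c → g (a ∷ c)) (allColourings k N)) (colours k)
sumBy-allColourings-suc k N g =
  trans (sumBy-concatMap g _ (colours k))
        (sumBy-cong (λ a → sumBy-map g (a ∷_) (allColourings k N)) (colours k))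

allColourings-cong : (k N : ℕ) {g h : Vec ℤ N → ℕ} → (∀ c → ColourVec k c → g c ≡ h c) →
  sumBy g (allColourings k N) ≡ sumBy h (allColourings k N)
allColourings-cong k zero    g≗h = cong (_+ 0) (g≗h [] (λ ()))
allColourings-cong k (suc N) {g} {h} g≗h = begin
  sumBy g (allColourings k (suc N))
    ≡⟨ sumBy-allColourings-suc k N g ⟩
  sumBy (λ a → sumBy (λ c → g (a ∷ c)) (allColourings k N)) (colours k)
    ≡⟨ colours-cong k (λ a a-col → allColourings-cong k N (λ c c-col →
         g≗h (a ∷ c) (λ { zero → a-col ; (suc i) → c-col i }))) ⟩
  sumBy (λ a → sumBy (λ c → h (a ∷ c)) (allColourings k N)) (colours k)
    ≡⟨ sym (sumBy-allColourings-suc k N h) ⟩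
  sumBy h (allColourings k (suc N))
    ∎ where open ≡-Reasoning

sumBy-allColourings-++ : (k N b : ℕ) (g : Vec ℤ (N + b) → ℕ) →
  sumBy g (allColourings k (N + b))
  ≡ sumBy (λ c → sumBy (λ d → g (c ++ᵛ d)) (allColourings k b)) (allColourings k N)
sumBy-allColourings-++ k zero    b g = sym (ℕ.+-identityʳ _)
sumBy-allColourings-++ k (suc N) b g = begin
  sumBy g (allColourings k (suc N + b))
    ≡⟨ sumBy-allColourings-suc k (N + b) g ⟩
  sumBy (λ a → sumBy (λ v → g (a ∷ v)) (allColourings k (N + b))) (colours k)
    ≡⟨ sumBy-cong (λ a → sumBy-allColourings-++ k N b (λ v → g (a ∷ v))) (colours k) ⟩
  sumBy (λ a → sumBy (λ c → sumBy (λ d → g (a ∷ c ++ᵛ d)) (allColourings k b)) (allColourings k N))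
        (colours k)
    ≡⟨ sym (sumBy-allColourings-suc k N _) ⟩
  sumBy (λ c → sumBy (λ d → g (c ++ᵛ d)) (allColourings k b)) (allColourings k (suc N))
    ∎ where open ≡-Reasoning

-- Walks: colourings of a positive path hanging off a vertex coloured a

walkFrom : {m : ℕ} → ℤ → Vec ℤ m → Bool
walkFrom a []       = true
walkFrom a (x ∷ xs) = (x ≠ᵇ a) ∧ walkFrom x xs

walkFrom-⋀ : {m : ℕ} (x : ℤ) (xs : Vec ℤ m) →
  walkFrom x xs ≡ ⋀ m (λ i → lookup (x ∷ xs) (suc i) ≠ᵇ lookup (x ∷ xs) (inject₁ i))
walkFrom-⋀ x []       = refl
walkFrom-⋀ x (y ∷ ys) = cong ((y ≠ᵇ x) ∧_) (walkFrom-⋀ y ys)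

walk-count : (k m : ℕ) (a : ℤ) → IsColour k a →
  sumBy (λ d → 𝟙 (walkFrom a d)) (allColourings k m) ≡ (2 * k ∸ 1) ^ m
walk-count k zero    a a-col = refl
walk-count k (suc m) a a-col = begin
  sumBy (λ d → 𝟙 (walkFrom a d)) (allColourings k (suc m))
    ≡⟨ sumBy-allColourings-suc k m _ ⟩
  sumBy (λ x → sumBy (λ d → 𝟙 ((x ≠ᵇ a) ∧ walkFrom x d)) (allColourings k m)) (colours k)
    ≡⟨ colours-cong k (λ x x-col →
         trans (sumBy-∧ (x ≠ᵇ a) (walkFrom x) (allColourings k m))
               (cong (𝟙 (x ≠ᵇ a) *_) (walk-count k m x x-col))) ⟩
  sumBy (λ x → 𝟙 (x ≠ᵇ a) * (2 * k ∸ 1) ^ m) (colours k)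
    ≡⟨ sumBy-*ʳ _ _ (colours k) ⟩
  sumBy (λ x → 𝟙 (x ≠ᵇ a)) (colours k) * (2 * k ∸ 1) ^ m
    ≡⟨ cong (_* (2 * k ∸ 1) ^ m) (colours-avoiding k a a-col) ⟩
  (2 * k ∸ 1) ^ suc m
    ∎ where open ≡-Reasoning

proper-pendantPath : (G : SignedGraph) (u : Fin (n G)) (m : ℕ)
  (c : Vec ℤ (n G)) (d : Vec ℤ (suc m)) →
  does (proper? (pendantPath G u (suc m)) (c ++ᵛ d)) ≡ does (proper? G c) ∧ walkFrom (lookup c u) d
proper-pendantPath G u m c d@(x ∷ xs) = begin
  does (all? p (map lift (edges G) ++ e₀ ∷ map pathEdge (allFin m)))
    ≡⟨ all?-++ p (map lift (edges G)) _ ⟩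
  does (all? p (map lift (edges G))) ∧ (does (p e₀) ∧ does (all? p (map pathEdge (allFin m))))
    ≡⟨ cong₂ _∧_ (all?-map p (properAt? c) lift lifted-edge (edges G))
                 (cong₂ _∧_ first-edge path-edges) ⟩
  does (proper? G c) ∧ ((x ≠ᵇ lookup c u) ∧ walkFrom x xs)
    ∎
  where
  open ≡-Reasoning
  p = properAt? (c ++ᵛ d)
  lift : Edge (n G) → Edge (n G + suc m)
  lift (y , z , s) = y ↑ˡ suc m , z ↑ˡ suc m , s
  e₀ : Edge (n G + suc m)
  e₀ = u ↑ˡ suc m , n G ↑ʳ zero , pos
  pathEdge : Fin m → Edge (n G + suc m)
  pathEdge i = n G ↑ʳ inject₁ i , n G ↑ʳ suc i , pos

  lifted-edge : ∀ e → does (p (lift e)) ≡ does (properAt? c e)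
  lifted-edge (y , z , s) rewrite lookup-++ˡ c d y | lookup-++ˡ c d z = refl

  first-edge : does (p e₀) ≡ x ≠ᵇ lookup c u
  first-edge rewrite lookup-++ˡ c d u | lookup-++ʳ c d (zero {m}) = refl

  path-edge : ∀ i → does (p (pathEdge i)) ≡ lookup d (suc i) ≠ᵇ lookup d (inject₁ i)
  path-edge i rewrite lookup-++ʳ c d (suc i) | lookup-++ʳ c d (inject₁ i) = refl

  path-edges : does (all? p (map pathEdge (allFin m))) ≡ walkFrom x xs
  path-edges = begin
    does (all? p (map pathEdge (allFin m)))
      ≡⟨ cong (λ es → does (all? p es)) (map-tabulate (λ i → i) pathEdge) ⟩
    does (all? p (tabulate pathEdge))
      ≡⟨ all?-tabulate p m pathEdge ⟩
    ⋀ m (λ i → does (p (pathEdge i)))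
      ≡⟨ ⋀-cong m path-edge ⟩
    ⋀ m (λ i → lookup d (suc i) ≠ᵇ lookup d (inject₁ i))
      ≡⟨ sym (walkFrom-⋀ x xs) ⟩
    walkFrom x xs
      ∎

proper-extensions : (G : SignedGraph) (u : Fin (n G)) (m k : ℕ) (c : Vec ℤ (n G)) → ColourVec k c →
  sumBy (λ d → 𝟙 (does (proper? (pendantPath G u (suc m)) (c ++ᵛ d)))) (allColourings k (suc m))
  ≡ 𝟙 (does (proper? G c)) * (2 * k ∸ 1) ^ suc m
proper-extensions G u m k c c-col = begin
  sumBy (λ d → 𝟙 (does (proper? (pendantPath G u (suc m)) (c ++ᵛ d)))) (allColourings k (suc m))
    ≡⟨ sumBy-cong (λ d → cong 𝟙 (proper-pendantPath G u m c d)) (allColourings k (suc m)) ⟩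
  sumBy (λ d → 𝟙 (does (proper? G c) ∧ walkFrom (lookup c u) d)) (allColourings k (suc m))
    ≡⟨ sumBy-∧ (does (proper? G c)) (walkFrom (lookup c u)) (allColourings k (suc m)) ⟩
  𝟙 (does (proper? G c)) * sumBy (λ d → 𝟙 (walkFrom (lookup c u) d)) (allColourings k (suc m))
    ≡⟨ cong (𝟙 (does (proper? G c)) *_) (walk-count k (suc m) (lookup c u) (c-col u)) ⟩
  𝟙 (does (proper? G c)) * (2 * k ∸ 1) ^ suc m
    ∎ where open ≡-Reasoning

lemma7p3 : (G : SignedGraph) (u : Fin (SignedGraph.n G)) (l : ℕ) → 1 ≤ l →
    (k : ℕ) → 1 ≤ k →
    χᵇ (pendantPath G u l) k ≡ (2 * k ∸ 1) ^ l * χᵇ G k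
lemma7p3 G u (suc m) _ k _ = begin
  χᵇ G⁺ k
    ≡⟨ length-filter (proper? G⁺) (allColourings k (n G + suc m)) ⟩
  sumBy (λ v → 𝟙 (does (proper? G⁺ v))) (allColourings k (n G + suc m))
    ≡⟨ sumBy-allColourings-++ k (n G) (suc m) _ ⟩
  sumBy (λ c → sumBy (λ d → 𝟙 (does (proper? G⁺ (c ++ᵛ d)))) (allColourings k (suc m)))
        (allColourings k (n G))
    ≡⟨ allColourings-cong k (n G) (proper-extensions G u m k) ⟩
  sumBy (λ c → 𝟙 (does (proper? G c)) * P) (allColourings k (n G))
    ≡⟨ sumBy-*ʳ _ P (allColourings k (n G)) ⟩
  sumBy (λ c → 𝟙 (does (proper? G c))) (allColourings k (n G)) * P
    ≡⟨ cong (_* P) (sym (length-filter (proper? G) (allColourings k (n G)))) ⟩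
  χᵇ G k * P
    ≡⟨ ℕ.*-comm (χᵇ G k) P ⟩
  P * χᵇ G k
    ∎
  where
  open ≡-Reasoning
  G⁺ = pendantPath G u (suc m)
  P  = (2 * k ∸ 1) ^ suc m
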